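{- Let $D$ be a directed graph on $[n]$ (loops allowed). The following are equivalent: (a) $\mathrm{crank}[D]=2^n$; (b) $\mathrm{minrank}[D,2]=2^n$; (c) $\mathrm{minrank}[D]=2^n$; (d) $D$ is a disjoint union of (directed) cycles; (e) $\mathrm{C}(D)$ has $n$ connected components, each isomorphic to $\vec P_1$, the directed path with one arc.
   Context: For $q\ge2$, $\langle q\rangle=\{0,\dots,q-1\}$. For $f:\langle q\rangle^n\to\langle q\rangle^n$, $\mathrm{IG}(f)$ is the graph on $[n]$ with an arc $uv$ iff there exist $a,b$ differing only in coordinate $u$ with $f_v(a)\ne f_v(b)$; $F[D,q]=\{f:\mathrm{IG}(f)=D\}$; $\operatorname{rank}(f)$ is the number of images of $f$; $\mathrm{minrank}[D,q]=\min_{f\in F[D,q]}\operatorname{rank}(f)$, $\mathrm{minrank}[D]=\min_{q\ge 2}\mathrm{minrank}[D,q]$. The conjunctive network on $D$ is $f:\{0,1\}^n\to\{0,1\}^n$ with $f_v(x)=\bigwedge_{u\in N^-(v)}x_u$ (empty conjunction equal to $1$), and $\mathrm{crank}[D]$ is its rank. A disjoint union of cycles means every vertex has in-degree and out-degree exactly one (loops count as cycles of length one). Canonical version $\mathrm{C}(D)$ (vertices of $D$ ordered as integers): (1) $D'$ has vertex set $V_0\cup V_1$, $V_i=\{v_i: v\in[n]\}$, and arcs $\{u_0v_1: uv \text{ an arc of } D\}$; (2) $v_1\in V_1$ is redundant if there exists $S\subseteq V_1\setminus\{v_1\}$ with $N^-(S)=N^-(v_1)$ in $D'$ and such that if $S$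 contains exactly one non-isolated vertex $u_1$ then $u<v$; $D''$ is $D'$ minus all redundant vertices of $V_1$; (3) $v_0\in V_0$ is redundant in $D''$ if it is isolated in $D''$ or there is $u<v$ with $N^+(u_0)=N^+(v_0)$ in $D''$; $\mathrm{C}(D)$ is $D''$ minus these redundant vertices. Here $N^-(S)=\bigcup_{s\in S}N^-(s)$. -}

module Defs where

open import Data.Nat using (ℕ; zero; suc; _≤_; _<_)
open import Data.Bool using (Bool; true; false; not; _∨_; if_then_else_)
open import Data.Fin as Fin using (Fin)
open import Data.Fin.Subset using (Subset) renaming (_∈_ to _∈ₛ_; _∉_ to _∉ₛ_)
open import Data.Vec using (Vec; lookup; tabulate) renaming ([] to []ᵛ; _∷_ to _∷ᵛ_)
open import Data.Vec.Properties using (≡-dec)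
open import Data.List using (List; []; _∷_; [_]; map; concatMap; allFin; filter; length; filterᵇ)
open import Data.Sum using (_⊎_)
open import Data.Empty using (⊥)
open import Data.List.Relation.Unary.Any using (any?)
open import Data.Product using (Σ; _×_; ∃; ∃-syntax; _,_)
open import Relation.Binary.PropositionalEquality using (_≡_; _≢_)
open import Relation.Nullary using (¬_)
open import Function.Bundles using (_⇔_)
open import Function.Definitions using (Injective)

Digraph : ℕ → Set
Digraph n = Fin n → Fin n → Bool

Arc : ∀ {n} → Digraph n → Fin n → Fin n → Set
Arc D u v = D u v ≡ true

State : ℕ → ℕ → Set
State q n = Vec (Fin q) n

Network : ℕ → ℕ → Set
Network q n = State q n → State q n

allStates : ∀ q n → List (State q n)
allStates q zero    = [ []ᵛ ]
allStates q (suc n) = concatMap (λ i → map (i ∷ᵛ_) (allStates q n)) (allFin q)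

rank : ∀ {q n} → Network q n → ℕ
rank {q} {n} f =
  length (filter (λ y → any? (λ x → ≡-dec Fin._≟_ (f x) y) (allStates q n))
                 (allStates q n))

IGArc : ∀ {q n} → Network q n → Fin n → Fin n → Set
IGArc {q} {n} f u v =
  ∃[ a ] ∃[ b ] ((∀ w → w ≢ u → lookup a w ≡ lookup b w)
                 × lookup (f a) v ≢ lookup (f b) v)

InF : ∀ {n} → Digraph n → (q : ℕ) → Network q n → Set
InF {n} D q f = ∀ (u v : Fin n) → (Arc D u v ⇔ IGArc f u v)

MinRankIs : ∀ {n} → Digraph n → (q : ℕ) → ℕ → Set
MinRankIs {n} D q m =
  (Σ (Network q n) λ f → InF D q f × rank f ≡ m)
  × (∀ (f : Network q n) → InF D q f → m ≤ rank f)

MinRankAllIs : ∀ {n} → Digraph n → ℕ → Set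
MinRankAllIs {n} D m =
  (Σ ℕ λ q → 2 ≤ q × Σ (Network q n) λ f → InF D q f × rank f ≡ m)
  × (∀ (q : ℕ) → 2 ≤ q → ∀ (f : Network q n) → InF D q f → m ≤ rank f)

allᵇ : ∀ {A : Set} → (A → Bool) → List A → Bool
allᵇ p []       = true
allᵇ p (x ∷ xs) = if p x then allᵇ p xs else false

isOne : Fin 2 → Bool
isOne Fin.zero           = false
isOne (Fin.suc Fin.zero) = true

conj : ∀ {n} → Digraph n → Network 2 n
conj {n} D x = tabulate λ v →
  if allᵇ (λ u → not (D u v) ∨ isOne (lookup x u)) (allFin n)
  then Fin.suc Fin.zero else Fin.zero

crank : ∀ {n} → Digraph n → ℕ
crank D = rank (conj D)

indeg : ∀ {n} → Digraph n → Fin n → ℕ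
indeg {n} D v = length (filterᵇ (λ u → D u v) (allFin n))

outdeg : ∀ {n} → Digraph n → Fin n → ℕ
outdeg {n} D u = length (filterᵇ (λ v → D u v) (allFin n))

DisjointUnionOfCycles : ∀ {n} → Digraph n → Set
DisjointUnionOfCycles D = ∀ v → indeg D v ≡ 1 × outdeg D v ≡ 1

-- Canonical version C(D).
-- Vertices of D' are (V₀ , v) = v₀ and (V₁ , v) = v₁; the arcs of D' are
-- u₀ → v₁ for every arc u → v of D.

data Side : Set where
  V₀ V₁ : Side

NonIsolated₁ : ∀ {n} → Digraph n → Fin n → Set
NonIsolated₁ D v = ∃[ w ] Arc D w v

Redundant₁ : ∀ {n} → Digraph n → Fin n → Set
Redundant₁ {n} D v =
  Σ (Subset n) λ S →
    v ∉ₛ S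
    × (∀ w → ((∃[ s ] (s ∈ₛ S × Arc D w s)) ⇔ Arc D w v))
    × (∀ u → u ∈ₛ S → NonIsolated₁ D u
           → (∀ u′ → u′ ∈ₛ S → NonIsolated₁ D u′ → u′ ≡ u)
           → u Fin.< v)

Arc'' : ∀ {n} → Digraph n → Fin n → Fin n → Set
Arc'' D u v = Arc D u v × ¬ Redundant₁ D v

Redundant₀ : ∀ {n} → Digraph n → Fin n → Set
Redundant₀ D v =
  (¬ (∃[ w ] Arc'' D v w))
  ⊎ (∃[ u ] (u Fin.< v × (∀ w → (Arc'' D u w ⇔ Arc'' D v w))))

CVertex : ∀ {n} → Digraph n → Side × Fin n → Set
CVertex D (V₀ , v) = ¬ Redundant₀ D v
CVertex D (V₁ , v) = ¬ Redundant₁ D v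

CArc : ∀ {n} → Digraph n → Side × Fin n → Side × Fin n → Set
CArc D (V₀ , u) (V₁ , v) = Arc D u v × ¬ Redundant₀ D u × ¬ Redundant₁ D v
CArc D _        _        = ⊥

P1Arc : ∀ {n} → Side × Fin n → Side × Fin n → Set
P1Arc (V₀ , i) (V₁ , j) = i ≡ j
P1Arc _        _        = ⊥

-- An isomorphism is given as an injective map
-- φ from the vertices of n·P⃗₁ onto the vertex set of C(D) which preserves
-- and reflects arcs.
CanonicalIsNP1 : ∀ {n} → Digraph n → Set
CanonicalIsNP1 {n} D =
  Σ (Side × Fin n → Side × Fin n) λ φ →
    Injective _≡_ _≡_ φ
    × (∀ x → (CVertex D x ⇔ (∃[ y ] φ y ≡ x)))
    × (∀ y y′ → (CArc D (φ y) (φ y′) ⇔ P1Arc y y′))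

-- Each condition is equivalent to: every vertex v of D has exactly one
-- in-neighbour pred v and exactly one out-neighbour succ v.  Then every f with
-- IG(f) = D has f_v depending on x_{pred v} alone and non-constantly, so picking
-- two values of each coordinate embeds {0,1}^n into the image of f, while the
-- conjunctive network is the bijection x ↦ x ∘ pred.  Conversely, if the
-- conjunctive network is onto, a preimage of the state that is 0 exactly at v
-- exhibits an in-neighbour of v whose only out-neighbour is v; these are
-- pairwise distinct, hence exhaust [n], which forces unique neighbours.  For the
-- canonical version: with unique neighbours no vertex of D' is redundant and the
-- arcs u₀ → (succ u)₁ form a perfect matching; conversely an isomorphism
-- C(D) ≅ n·P⃗₁ is onto all 2n vertices, so C(D) = D' and its arcs form a
-- perfect matching.
module Submission where

open import Defs
open import Data.Bool using (Bool; true; false; not; _∨_; if_then_else_; T)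
open import Data.Bool.Properties as Bool using (T-≡; T?)
open import Data.Empty using (⊥-elim)
open import Data.Fin as Fin using (Fin)
open import Data.Fin.Patterns using (0F; 1F)
open import Data.Fin.Properties as FinP using ()
open import Data.Fin.Subset using () renaming (⊥ to ∅; _∈_ to _∈ₛ_)
open import Data.Fin.Subset.Properties using (∉⊥)
open import Data.List
  using ( List; []; _∷_; [_]; _++_; map; length; filter; filterᵇ; allFin
        ; concatMap; cartesianProductWith; cartesianProduct)
open import Data.List.Properties
  using (length-map; length-++; length-filter; length-tabulate; filter-notAll; filter-all)
open import Data.List.Membership.Propositional using (_∈_)
open import Data.List.Membership.Propositional.Properties
  using ( ∈-∃++; ∈-++⁺ˡ; ∈-++⁺ʳ; ∈-++⁻; ∈-map⁻; ∈-filter⁺; ∈-filter⁻; ∈-allFin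
        ; ∈-cartesianProductWith⁺; ∈-cartesianProduct⁺)
open import Data.List.Relation.Binary.Subset.Propositional using (_⊆_)
open import Data.List.Relation.Unary.All as All using (All; []; _∷_)
open import Data.List.Relation.Unary.AllPairs using ([]; _∷_)
open import Data.List.Relation.Unary.Any as Any using (Any; here; there; any?)
open import Data.List.Relation.Unary.Unique.Propositional using (Unique)
import Data.List.Relation.Unary.Unique.Propositional.Properties as Unique
open import Data.Nat using (ℕ; zero; suc; _+_; _*_; _^_; _≤_; _<_; z≤n; s≤s)
open import Data.Nat.Properties
  using (≤-refl; ≤-trans; ≤-reflexive; <-irrefl; ≤-antisym; +-suc; module ≤-Reasoning)
open import Data.Product using (∃!; ∃-syntax; _×_; _,_; proj₁; proj₂)
open import Data.Product.Properties using () renaming (≡-dec to ≡-dec×)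
open import Data.Sum using (_⊎_; inj₁; inj₂)
open import Data.Vec using (Vec; lookup; tabulate; replicate; _[_]≔_) renaming ([] to []ᵛ; _∷_ to _∷ᵛ_)
open import Data.Vec.Properties
  using ( ≡-dec; ∷-injective; tabulate∘lookup; tabulate-cong
        ; lookup∘tabulate; lookup∘update; lookup∘update′; lookup-replicate)
open import Function.Bundles using (_⇔_; mk⇔; Equivalence)
open import Function.Construct.Composition using (_⇔-∘_)
open import Function.Definitions using (Injective)
open import Relation.Binary.Definitions using (DecidableEquality)
open import Relation.Binary.PropositionalEquality
  using (_≡_; _≢_; refl; sym; trans; cong; cong₂; subst; subst₂; module ≡-Reasoning)
open import Relation.Nullary using (¬_; Dec; yes; no; ¬?; contradiction; _×-dec_)

open Equivalence using (to; from)

-- Counting in finite lists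

Unique⇒length≤ : ∀ {A : Set} {xs ys : List A} → Unique xs → xs ⊆ ys → length xs ≤ length ys
Unique⇒length≤ {xs = []}     _             _     = z≤n
Unique⇒length≤ {xs = x ∷ xs} {ys} (x∉xs ∷ xs!) xs⊆ys with ∈-∃++ (xs⊆ys (here refl))
... | ys₁ , ys₂ , refl = begin
  suc (length xs)            ≤⟨ s≤s (Unique⇒length≤ xs! xs⊆ys₁++ys₂) ⟩
  suc (length (ys₁ ++ ys₂))  ≡⟨ cong suc (length-++ ys₁) ⟩
  suc (length ys₁ + length ys₂)  ≡⟨ +-suc (length ys₁) (length ys₂) ⟨
  length ys₁ + length (x ∷ ys₂)  ≡⟨ length-++ ys₁ ⟨
  length (ys₁ ++ x ∷ ys₂)    ∎
  where
  open ≤-Reasoning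
  xs⊆ys₁++ys₂ : xs ⊆ ys₁ ++ ys₂
  xs⊆ys₁++ys₂ {z} z∈xs with ∈-++⁻ ys₁ (xs⊆ys (there z∈xs))
  ... | inj₁ z∈ys₁         = ∈-++⁺ˡ z∈ys₁
  ... | inj₂ (here refl)   = ⊥-elim (All.lookup x∉xs z∈xs refl)
  ... | inj₂ (there z∈ys₂) = ∈-++⁺ʳ ys₁ z∈ys₂

module _ {A : Set} (_≟_ : DecidableEquality A) (xs : List A) (xs! : Unique xs) (∈xs : ∀ x → x ∈ xs) where

  injective⇒surjective : (f : A → A) → Injective _≡_ _≡_ f → ∀ y → ∃[ x ] f x ≡ y
  injective⇒surjective f f-injective y with any? (λ x → f x ≟ y) xs
  ... | yes hit = Any.satisfied hit
  ... | no miss = ⊥-elim (<-irrefl refl too-long)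
    where
    ≢y? : ∀ z → Dec (z ≢ y)
    ≢y? z = ¬? (z ≟ y)
    image⊆others : map f xs ⊆ filter ≢y? xs
    image⊆others z∈ with ∈-map⁻ f z∈
    ... | x , x∈xs , refl =
      ∈-filter⁺ ≢y? (∈xs (f x)) λ fx≡y → miss (Any.map (λ { refl → fx≡y }) x∈xs)
    too-long : length xs < length xs
    too-long = begin-strict
      length xs               ≡⟨ length-map f xs ⟨
      length (map f xs)       ≤⟨ Unique⇒length≤ (Unique.map⁺ f-injective xs!) image⊆others ⟩
      length (filter ≢y? xs)  <⟨ filter-notAll ≢y? xs (Any.map (λ { refl y≢y → y≢y refl }) (∈xs y)) ⟩
      length xs               ∎
      where open ≤-Reasoning

concatMap-map≡cartesianProductWith : ∀ {A B C : Set} (f : A → B → C) xs ys →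
                                     concatMap (λ x → map (f x) ys) xs ≡ cartesianProductWith f xs ys
concatMap-map≡cartesianProductWith f []       ys = refl
concatMap-map≡cartesianProductWith f (x ∷ xs) ys =
  cong (map (f x) ys ++_) (concatMap-map≡cartesianProductWith f xs ys)

length-cartesianProductWith : ∀ {A B C : Set} (f : A → B → C) xs ys →
                              length (cartesianProductWith f xs ys) ≡ length xs * length ys
length-cartesianProductWith f []       ys = refl
length-cartesianProductWith f (x ∷ xs) ys = begin
  length (map (f x) ys ++ cartesianProductWith f xs ys)          ≡⟨ length-++ (map (f x) ys) ⟩
  length (map (f x) ys) + length (cartesianProductWith f xs ys)
    ≡⟨ cong₂ _+_ (length-map (f x) ys) (length-cartesianProductWith f xs ys) ⟩
  length ys + length xs * length ys                              ∎
  where open ≡-Reasoning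

-- The state space and the rank

module _ (q : ℕ) where

  allStates-suc : ∀ n → allStates q (suc n) ≡ cartesianProductWith _∷ᵛ_ (allFin q) (allStates q n)
  allStates-suc n = concatMap-map≡cartesianProductWith _∷ᵛ_ (allFin q) (allStates q n)

  allStates-complete : ∀ {n} (x : State q n) → x ∈ allStates q n
  allStates-complete []ᵛ      = here refl
  allStates-complete (i ∷ᵛ x) = subst ((i ∷ᵛ x) ∈_) (sym (allStates-suc _))
    (∈-cartesianProductWith⁺ _∷ᵛ_ (∈-allFin i) (allStates-complete x))

  allStates-unique : ∀ n → Unique (allStates q n)
  allStates-unique zero    = [] ∷ []
  allStates-unique (suc n) = subst Unique (sym (allStates-suc n))
    (Unique.cartesianProductWith⁺ _∷ᵛ_ ∷-injective (Unique.allFin⁺ q) (allStates-unique n))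

  length-allStates : ∀ n → length (allStates q n) ≡ q ^ n
  length-allStates zero    = refl
  length-allStates (suc n) = begin
    length (allStates q (suc n))                                   ≡⟨ cong length (allStates-suc n) ⟩
    length (cartesianProductWith _∷ᵛ_ (allFin q) (allStates q n))
      ≡⟨ length-cartesianProductWith _∷ᵛ_ (allFin q) (allStates q n) ⟩
    length (allFin q) * length (allStates q n)
      ≡⟨ cong₂ _*_ (length-tabulate {n = q} (λ i → i)) (length-allStates n) ⟩
    q * q ^ n                                                      ∎
    where open ≡-Reasoning

module _ {q n : ℕ} (f : Network q n) where

  private
    image? : ∀ y → Dec (Any (λ x → f x ≡ y) (allStates q n))
    image? y = any? (λ x → ≡-dec Fin._≟_ (f x) y) (allStates q n)

    inImage : ∀ {y} → ∃[ x ] f x ≡ y → Any (λ x → f x ≡ y) (allStates q n)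
    inImage (x , fx≡y) = Any.map (λ { refl → fx≡y }) (allStates-complete q x)

  rank≤ : rank f ≤ q ^ n
  rank≤ = ≤-trans (length-filter image? (allStates q n)) (≤-reflexive (length-allStates q n))

  rank≡⇒surjective : rank f ≡ q ^ n → ∀ y → ∃[ x ] f x ≡ y
  rank≡⇒surjective full y with image? y
  ... | yes hit = Any.satisfied hit
  ... | no miss = ⊥-elim (<-irrefl full rank<)
    where
    rank< : rank f < q ^ n
    rank< = ≤-trans (filter-notAll image? (allStates q n) (Any.map (λ { refl → miss }) (allStates-complete q y)))
                    (≤-reflexive (length-allStates q n))

  surjective⇒rank≡ : (∀ y → ∃[ x ] f x ≡ y) → rank f ≡ q ^ n
  surjective⇒rank≡ onto = begin
    rank f
      ≡⟨ cong length (filter-all image? {xs = allStates q n} (All.tabulate (λ {y} _ → inImage (onto y)))) ⟩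
    length (allStates q n)  ≡⟨ length-allStates q n ⟩
    q ^ n                   ∎
    where open ≡-Reasoning

  injectionIntoImage⇒≤rank : ∀ {p} (g : State p n → State q n) → Injective _≡_ _≡_ g →
                             (∀ s → ∃[ x ] f x ≡ g s) → p ^ n ≤ rank f
  injectionIntoImage⇒≤rank {p} g g-injective g⊆image = begin
    p ^ n                           ≡⟨ length-allStates p n ⟨
    length (allStates p n)          ≡⟨ length-map g (allStates p n) ⟨
    length (map g (allStates p n))
      ≤⟨ Unique⇒length≤ (Unique.map⁺ g-injective (allStates-unique p n)) g[all]⊆image ⟩
    rank f                          ∎
    where
    open ≤-Reasoning
    g[all]⊆image : map g (allStates p n) ⊆ filter image? (allStates q n)
    g[all]⊆image y∈ with ∈-map⁻ g y∈
    ... | s , _ , refl = ∈-filter⁺ image? (allStates-complete q (g s)) (inImage (g⊆image s))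

-- Digraphs in which every vertex has a unique in- and a unique out-neighbour

module _ {n : ℕ} (P : Fin n → Bool) where

  private
    P? : ∀ x → Dec (T (P x))
    P? x = T? (P x)

  count≡1⇔∃! : length (filterᵇ P (allFin n)) ≡ 1 ⇔ ∃! _≡_ (λ c → P c ≡ true)
  count≡1⇔∃! = mk⇔ count≡1⇒∃! ∃!⇒count≡1
    where
    ∈⇒P : ∀ {u} → u ∈ filterᵇ P (allFin n) → P u ≡ true
    ∈⇒P u∈ = to T-≡ (proj₂ (∈-filter⁻ P? {xs = allFin n} u∈))
    P⇒∈ : ∀ {u} → P u ≡ true → u ∈ filterᵇ P (allFin n)
    P⇒∈ {u} Pu = ∈-filter⁺ P? (∈-allFin u) (from T-≡ Pu)

    count≡1⇒∃! : length (filterᵇ P (allFin n)) ≡ 1 → ∃! _≡_ (λ c → P c ≡ true)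
    count≡1⇒∃! count≡1 with filterᵇ P (allFin n) in eq
    count≡1⇒∃! refl | c ∷ [] = c , ∈⇒P (subst (c ∈_) (sym eq) (here refl)) , only-c
      where
      only-c : ∀ {u} → P u ≡ true → c ≡ u
      only-c Pu with subst (_ ∈_) eq (P⇒∈ Pu)
      ... | here u≡c = sym u≡c

    ∃!⇒count≡1 : ∃! _≡_ (λ c → P c ≡ true) → length (filterᵇ P (allFin n)) ≡ 1
    ∃!⇒count≡1 (c , Pc , only-c) = ≤-antisym ≤1 (1≤ (P⇒∈ Pc))
      where
      ≤1 : length (filterᵇ P (allFin n)) ≤ 1
      ≤1 = Unique⇒length≤ {ys = [ c ]} (Unique.filter⁺ P? (Unique.allFin⁺ n))
                                       (λ u∈ → here (sym (only-c (∈⇒P u∈))))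
      1≤ : ∀ {xs : List (Fin n)} → c ∈ xs → 1 ≤ length xs
      1≤ (here _)  = s≤s z≤n
      1≤ (there _) = s≤s z≤n

record UniqueNeighbours {n : ℕ} (D : Digraph n) : Set where
  field
    succ pred  : Fin n → Fin n
    succ-arc   : ∀ u → Arc D u (succ u)
    pred-arc   : ∀ v → Arc D (pred v) v
    out-unique : ∀ {u v w} → Arc D u v → Arc D u w → v ≡ w
    in-unique  : ∀ {u v w} → Arc D u w → Arc D v w → u ≡ v

  arc⇒≡succ : ∀ {u v} → Arc D u v → v ≡ succ u
  arc⇒≡succ uv = out-unique uv (succ-arc _)

  arc⇒≡pred : ∀ {u v} → Arc D u v → u ≡ pred v
  arc⇒≡pred uv = in-unique uv (pred-arc _)

  pred∘succ : ∀ u → pred (succ u) ≡ u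
  pred∘succ u = sym (arc⇒≡pred (succ-arc u))

  succ∘pred : ∀ v → succ (pred v) ≡ v
  succ∘pred v = sym (arc⇒≡succ (pred-arc v))

PrivateInNeighbour : ∀ {n} → Digraph n → Fin n → Fin n → Set
PrivateInNeighbour D u v = Arc D u v × (∀ w → Arc D u w → w ≡ v)

module _ {n : ℕ} (D : Digraph n) where

  UniqueNeighbours⇔DisjointUnionOfCycles : UniqueNeighbours D ⇔ DisjointUnionOfCycles D
  UniqueNeighbours⇔DisjointUnionOfCycles = mk⇔ degrees neighbours
    where
    degrees : UniqueNeighbours D → DisjointUnionOfCycles D
    degrees un v = from (count≡1⇔∃! (λ u → D u v)) (pred v , pred-arc v , λ uv → sym (arc⇒≡pred uv))
                 , from (count≡1⇔∃! (D v))        (succ v , succ-arc v , λ vw → sym (arc⇒≡succ vw))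
      where open UniqueNeighbours un

    neighbours : DisjointUnionOfCycles D → UniqueNeighbours D
    neighbours duc = record
      { succ = λ u → proj₁ (out u) ; succ-arc = λ u → proj₁ (proj₂ (out u))
      ; pred = λ v → proj₁ (inn v) ; pred-arc = λ v → proj₁ (proj₂ (inn v))
      ; out-unique = λ {u} uv uw → trans (sym (proj₂ (proj₂ (out u)) uv)) (proj₂ (proj₂ (out u)) uw)
      ; in-unique  = λ {w = w} uw vw → trans (sym (proj₂ (proj₂ (inn w)) uw)) (proj₂ (proj₂ (inn w)) vw)
      }
      where
      out : ∀ u → ∃! _≡_ (λ w → D u w ≡ true)
      out u = to (count≡1⇔∃! (D u)) (proj₂ (duc u))
      inn : ∀ v → ∃! _≡_ (λ u → D u v ≡ true)
      inn v = to (count≡1⇔∃! (λ u → D u v)) (proj₁ (duc v))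

  -- Distinct vertices have distinct private in-neighbours, so by finiteness
  -- every vertex is the private in-neighbour of some vertex, its successor.
  privateInNeighbours⇒UniqueNeighbours : (∀ v → ∃[ u ] PrivateInNeighbour D u v) → UniqueNeighbours D
  privateInNeighbours⇒UniqueNeighbours private-in = record
    { succ = succ ; succ-arc = succ-arc ; pred = owner ; pred-arc = owner-arc
    ; out-unique = λ uv uw → trans (out-only uv) (sym (out-only uw))
    ; in-unique  = λ uw vw → trans (in-only uw) (sym (in-only vw))
    }
    where
    owner : Fin n → Fin n
    owner v = proj₁ (private-in v)
    owner-arc : ∀ v → Arc D (owner v) v
    owner-arc v = proj₁ (proj₂ (private-in v))
    owner-only : ∀ {v w} → Arc D (owner v) w → w ≡ v
    owner-only {v} = proj₂ (proj₂ (private-in v)) _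
    owner-injective : Injective _≡_ _≡_ owner
    owner-injective {v} {v′} same = sym (owner-only (subst (λ u → Arc D u v′) (sym same) (owner-arc v′)))
    owner-surjective : ∀ u → ∃[ v ] owner v ≡ u
    owner-surjective = injective⇒surjective Fin._≟_ (allFin n) (Unique.allFin⁺ n) ∈-allFin owner owner-injective
    succ : Fin n → Fin n
    succ u = proj₁ (owner-surjective u)
    owner∘succ : ∀ u → owner (succ u) ≡ u
    owner∘succ u = proj₂ (owner-surjective u)
    succ-arc : ∀ u → Arc D u (succ u)
    succ-arc u = subst (λ u′ → Arc D u′ (succ u)) (owner∘succ u) (owner-arc (succ u))
    out-only : ∀ {u w} → Arc D u w → w ≡ succ u
    out-only {u} {w} uw = owner-only (subst (λ u′ → Arc D u′ w) (sym (owner∘succ u)) uw)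
    in-only : ∀ {u w} → Arc D u w → u ≡ owner w
    in-only {u} uw = trans (sym (owner∘succ u)) (cong owner (sym (out-only uw)))

-- The conjunctive network

lookup-extensionality : ∀ {A : Set} {n} {xs ys : Vec A n} → (∀ i → lookup xs i ≡ lookup ys i) → xs ≡ ys
lookup-extensionality {xs = xs} {ys} xs≗ys = begin
  xs                    ≡⟨ tabulate∘lookup xs ⟨
  tabulate (lookup xs)  ≡⟨ tabulate-cong xs≗ys ⟩
  tabulate (lookup ys)  ≡⟨ tabulate∘lookup ys ⟩
  ys                    ∎
  where open ≡-Reasoning

≢0F⇒≡1F : ∀ {b : Fin 2} → b ≢ 0F → b ≡ 1F
≢0F⇒≡1F {0F} b≢0 = contradiction refl b≢0
≢0F⇒≡1F {1F} _   = refl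

≡1F⇔≡1F⇒≡ : ∀ {a b : Fin 2} → (a ≡ 1F ⇔ b ≡ 1F) → a ≡ b
≡1F⇔≡1F⇒≡ {0F} {0F} _   = refl
≡1F⇔≡1F⇒≡ {0F} {1F} a⇔b = from a⇔b refl
≡1F⇔≡1F⇒≡ {1F} {0F} a⇔b = sym (to a⇔b refl)
≡1F⇔≡1F⇒≡ {1F} {1F} _   = refl

onesExcept : ∀ {n} → Fin n → State 2 n
onesExcept {n} u = replicate n 1F [ u ]≔ 0F

lookup-onesExcept-same : ∀ {n} (u : Fin n) → lookup (onesExcept u) u ≡ 0F
lookup-onesExcept-same {n} u = lookup∘update u (replicate n 1F) 0F

lookup-onesExcept-other : ∀ {n} {u w : Fin n} → w ≢ u → lookup (onesExcept u) w ≡ 1F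
lookup-onesExcept-other {n} {w = w} w≢u = trans (lookup∘update′ w≢u (replicate n 1F) 0F) (lookup-replicate w 1F)

allᵇ≡true⇔ : ∀ {A : Set} (p : A → Bool) xs → allᵇ p xs ≡ true ⇔ All (λ x → p x ≡ true) xs
allᵇ≡true⇔ p []       = mk⇔ (λ _ → []) (λ _ → refl)
allᵇ≡true⇔ p (x ∷ xs) with p x in px
... | true  = mk⇔ (λ all → px ∷ to (allᵇ≡true⇔ p xs) all)
                  (λ { (_ ∷ all) → from (allᵇ≡true⇔ p xs) all })
... | false = mk⇔ (λ ()) (λ { (px≡true ∷ _) → contradiction (trans (sym px) px≡true) λ () })

module _ {n : ℕ} (D : Digraph n) where

  conj≡1F⇔ : ∀ x v → lookup (conj D x) v ≡ 1F ⇔ (∀ u → Arc D u v → lookup x u ≡ 1F)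
  conj≡1F⇔ x v = mk⇔
    (λ conj≡1 u → inNeighbour⇒1F u (All.lookup (to all⇔ (if⇒ (trans (sym unfold) conj≡1))) (∈-allFin u)))
    (λ ones → trans unfold (if⇐ (from all⇔ (All.tabulate λ {u} _ → 1F⇒inNeighbour u (ones u)))))
    where
    p : Fin n → Bool
    p u = not (D u v) ∨ isOne (lookup x u)
    all⇔ : allᵇ p (allFin n) ≡ true ⇔ All (λ u → p u ≡ true) (allFin n)
    all⇔ = allᵇ≡true⇔ p (allFin n)
    unfold : lookup (conj D x) v ≡ (if allᵇ p (allFin n) then 1F else 0F)
    unfold = lookup∘tabulate _ v
    if⇒ : ∀ {b} → (if b then 1F else 0F) ≡ 1F → b ≡ true
    if⇒ {true} _ = refl
    if⇐ : ∀ {b} → b ≡ true → (if b then 1F else 0F) ≡ 1F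
    if⇐ refl = refl
    inNeighbour⇒1F : ∀ u → p u ≡ true → Arc D u v → lookup x u ≡ 1F
    inNeighbour⇒1F u pu uv with lookup x u
    ... | 0F = contradiction (subst (λ b → not b ∨ false ≡ true) uv pu) λ ()
    ... | 1F = refl
    1F⇒inNeighbour : ∀ u → (Arc D u v → lookup x u ≡ 1F) → p u ≡ true
    1F⇒inNeighbour u one with D u v
    ... | false = refl
    ... | true  rewrite one refl = refl

  conj≡0F⇒ : ∀ x v → lookup (conj D x) v ≡ 0F → ∃[ u ] (Arc D u v × lookup x u ≡ 0F)
  conj≡0F⇒ x v conj≡0 with FinP.any? (λ u → (D u v Bool.≟ true) ×-dec (lookup x u Fin.≟ 0F))
  ... | yes zeroInNeighbour = zeroInNeighbour
  ... | no  none            = contradiction (trans (sym conj≡0) (from (conj≡1F⇔ x v) allOnes)) λ ()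
    where
    allOnes : ∀ u → Arc D u v → lookup x u ≡ 1F
    allOnes u uv = ≢0F⇒≡1F (λ xu≡0 → none (u , uv , xu≡0))

  conj-cong : ∀ x y v → (∀ u → Arc D u v → lookup x u ≡ lookup y u) →
              lookup (conj D x) v ≡ lookup (conj D y) v
  conj-cong x y v x≈y = ≡1F⇔≡1F⇒≡ (mk⇔
    (λ cx → from (conj≡1F⇔ y v) λ u uv → trans (sym (x≈y u uv)) (to (conj≡1F⇔ x v) cx u uv))
    (λ cy → from (conj≡1F⇔ x v) λ u uv → trans (x≈y u uv) (to (conj≡1F⇔ y v) cy u uv)))

  conj-InF : InF D 2 (conj D)
  conj-InF u v = mk⇔ arc⇒IGArc IGArc⇒arc
    where
    ones : State 2 n
    ones = replicate n 1F
    arc⇒IGArc : Arc D u v → IGArc (conj D) u v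
    arc⇒IGArc uv = ones , onesExcept u , agreeOff , differ
      where
      agreeOff : ∀ w → w ≢ u → lookup ones w ≡ lookup (onesExcept u) w
      agreeOff w w≢u = trans (lookup-replicate w 1F) (sym (lookup-onesExcept-other w≢u))
      onesAtV : lookup (conj D ones) v ≡ 1F
      onesAtV = from (conj≡1F⇔ ones v) (λ w _ → lookup-replicate w 1F)
      differ : lookup (conj D ones) v ≢ lookup (conj D (onesExcept u)) v
      differ same = contradiction (to (conj≡1F⇔ (onesExcept u) v) (trans (sym same) onesAtV) u uv)
                                  (λ u≡1 → contradiction (trans (sym (lookup-onesExcept-same u)) u≡1) λ ())
    IGArc⇒arc : IGArc (conj D) u v → Arc D u v
    IGArc⇒arc (a , b , agreeOff , differ) with D u v in uv
    ... | true  = refl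
    ... | false = contradiction (conj-cong a b v agreeOnInNeighbours) differ
      where
      agreeOnInNeighbours : ∀ w → Arc D w v → lookup a w ≡ lookup b w
      agreeOnInNeighbours w wv = agreeOff w λ { refl → contradiction (trans (sym uv) wv) λ () }

  conj-surjective⇒privateInNeighbours : (∀ y → ∃[ x ] conj D x ≡ y) →
                                        ∀ v → ∃[ u ] PrivateInNeighbour D u v
  conj-surjective⇒privateInNeighbours onto v with onto (onesExcept v)
  ... | x , conj≡ with conj≡0F⇒ x v (trans (cong (λ y → lookup y v) conj≡) (lookup-onesExcept-same v))
  ... | u , uv , xu≡0 = u , uv , only-v
    where
    only-v : ∀ w → Arc D u w → w ≡ v
    only-v w uw with w Fin.≟ v
    ... | yes w≡v = w≡v
    ... | no  w≢v = contradiction (trans (sym xu≡0) (to (conj≡1F⇔ x w) conj≡1 u uw)) λ ()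
      where
      conj≡1 : lookup (conj D x) w ≡ 1F
      conj≡1 = trans (cong (λ y → lookup y w) conj≡) (lookup-onesExcept-other w≢v)

module _ {n : ℕ} {D : Digraph n} (un : UniqueNeighbours D) where
  open UniqueNeighbours un

  conj-copiesPred : ∀ x v → lookup (conj D x) v ≡ lookup x (pred v)
  conj-copiesPred x v = ≡1F⇔≡1F⇒≡ (mk⇔
    (λ conj≡1 → to (conj≡1F⇔ D x v) conj≡1 (pred v) (pred-arc v))
    (λ pred≡1 → from (conj≡1F⇔ D x v) λ u uv →
                  subst (λ u → lookup x u ≡ 1F) (sym (arc⇒≡pred uv)) pred≡1))

  conj-surjective : ∀ y → ∃[ x ] conj D x ≡ y
  conj-surjective y = x , lookup-extensionality λ v → begin
    lookup (conj D x) v       ≡⟨ conj-copiesPred x v ⟩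
    lookup x (pred v)         ≡⟨ lookup∘tabulate _ (pred v) ⟩
    lookup y (succ (pred v))  ≡⟨ cong (lookup y) (succ∘pred v) ⟩
    lookup y v                ∎
    where
    open ≡-Reasoning
    x : State 2 n
    x = tabulate (λ u → lookup y (succ u))

crank≡2^n⇔UniqueNeighbours : ∀ {n} (D : Digraph n) → crank D ≡ 2 ^ n ⇔ UniqueNeighbours D
crank≡2^n⇔UniqueNeighbours D = mk⇔
  (λ full → privateInNeighbours⇒UniqueNeighbours D
              (conj-surjective⇒privateInNeighbours D (rank≡⇒surjective (conj D) full)))
  (λ un → surjective⇒rank≡ (conj D) (conj-surjective un))

-- Networks with a given interaction graph

Insensitive : ∀ {q n} {A : Set} → (State q n → A) → Fin n → Set
Insensitive {q} {n} h u = ∀ (a b : State q n) → (∀ w → w ≢ u → lookup a w ≡ lookup b w) → h a ≡ h b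

¬IGArc⇒Insensitive : ∀ {q n} (f : Network q n) {u v} → ¬ IGArc f u v → Insensitive (λ x → lookup (f x) v) u
¬IGArc⇒Insensitive f {v = v} no-arc a b agree with lookup (f a) v Fin.≟ lookup (f b) v
... | yes same   = same
... | no  differ = contradiction (a , b , agree , differ) no-arc

insensitive⇒≡ : ∀ {q n} {A : Set} (h : State q n → A) (Free : Fin n → Set) →
                (∀ u → Free u → Insensitive h u) →
                ∀ a b → (∀ w → Free w ⊎ lookup a w ≡ lookup b w) → h a ≡ h b
insensitive⇒≡ h Free insensitive []ᵛ       []ᵛ       _     = refl
insensitive⇒≡ h Free insensitive (a₀ ∷ᵛ a) (b₀ ∷ᵛ b) agree = trans changeHead changeTail
  where
  changeHead : h (a₀ ∷ᵛ a) ≡ h (b₀ ∷ᵛ a)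
  changeHead with agree 0F
  ... | inj₁ free  = insensitive 0F free _ _ λ { 0F 0≢0 → contradiction refl 0≢0 ; (Fin.suc w) _ → refl }
  ... | inj₂ a₀≡b₀ = cong (λ c → h (c ∷ᵛ a)) a₀≡b₀
  insensitiveTail : ∀ u → Free (Fin.suc u) → Insensitive (λ x → h (b₀ ∷ᵛ x)) u
  insensitiveTail u free x y agreeOff = insensitive (Fin.suc u) free _ _
    λ { 0F _ → refl ; (Fin.suc w) w≢u → agreeOff w (λ w≡u → w≢u (cong Fin.suc w≡u)) }
  changeTail : h (b₀ ∷ᵛ a) ≡ h (b₀ ∷ᵛ b)
  changeTail = insensitive⇒≡ (λ x → h (b₀ ∷ᵛ x)) (λ w → Free (Fin.suc w)) insensitiveTail
                             a b (λ w → agree (Fin.suc w))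

module _ {q n : ℕ} {D : Digraph n} (un : UniqueNeighbours D) {f : Network q n} (f∈F : InF D q f) where
  open UniqueNeighbours un

  InF-determinedByPred : ∀ v a b → lookup a (pred v) ≡ lookup b (pred v) → lookup (f a) v ≡ lookup (f b) v
  InF-determinedByPred v a b same =
    insensitive⇒≡ (λ x → lookup (f x) v) (λ u → u ≢ pred v) insensitive a b agree
    where
    insensitive : ∀ u → u ≢ pred v → Insensitive (λ x → lookup (f x) v) u
    insensitive u u≢pred = ¬IGArc⇒Insensitive f λ arc → u≢pred (arc⇒≡pred (from (f∈F u v) arc))
    agree : ∀ w → w ≢ pred v ⊎ lookup a w ≡ lookup b w
    agree w with w Fin.≟ pred v
    ... | yes refl   = inj₂ same
    ... | no  w≢pred = inj₁ w≢pred

  -- The bit s v chooses which of the two witnesses of the arc pred v → v is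
  -- copied onto coordinate pred v; coordinate v of f then reveals s v.
  2^n≤rank : 2 ^ n ≤ rank f
  2^n≤rank = injectionIntoImage⇒≤rank f (λ s → f (encode s)) encode-injective (λ s → encode s , refl)
    where
    witness : ∀ v → IGArc f (pred v) v
    witness v = to (f∈F (pred v) v) (pred-arc v)
    choose : Fin 2 → Fin n → State q n
    choose 0F v = proj₁ (witness v)
    choose 1F v = proj₁ (proj₂ (witness v))
    choose-distinguishes : ∀ v {b c} → lookup (f (choose b v)) v ≡ lookup (f (choose c v)) v → b ≡ c
    choose-distinguishes v {0F} {0F} _ = refl
    choose-distinguishes v {0F} {1F} e = contradiction e (proj₂ (proj₂ (proj₂ (witness v))))
    choose-distinguishes v {1F} {0F} e = contradiction (sym e) (proj₂ (proj₂ (proj₂ (witness v))))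
    choose-distinguishes v {1F} {1F} _ = refl
    encode : State 2 n → State q n
    encode s = tabulate (λ u → lookup (choose (lookup s (succ u)) (succ u)) u)
    f∘encode : ∀ s v → lookup (f (encode s)) v ≡ lookup (f (choose (lookup s v) v)) v
    f∘encode s v = InF-determinedByPred v _ _ (begin
      lookup (encode s) (pred v)
        ≡⟨ lookup∘tabulate _ (pred v) ⟩
      lookup (choose (lookup s (succ (pred v))) (succ (pred v))) (pred v)
        ≡⟨ cong (λ w → lookup (choose (lookup s w) w) (pred v)) (succ∘pred v) ⟩
      lookup (choose (lookup s v) v) (pred v)
        ∎)
      where open ≡-Reasoning
    encode-injective : Injective _≡_ _≡_ (λ s → f (encode s))
    encode-injective {s} {t} same = lookup-extensionality λ v → choose-distinguishes v
      (trans (sym (f∘encode s v)) (trans (cong (λ y → lookup y v) same) (f∘encode t v)))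

module _ {n : ℕ} (D : Digraph n) where

  private
    crank≡2^n : (2 ^ n ≤ crank D) → crank D ≡ 2 ^ n
    crank≡2^n 2^n≤crank = ≤-antisym (rank≤ (conj D)) 2^n≤crank

  minrank₂≡2^n⇔UniqueNeighbours : MinRankIs D 2 (2 ^ n) ⇔ UniqueNeighbours D
  minrank₂≡2^n⇔UniqueNeighbours = mk⇔
    (λ (_ , lower) → to (crank≡2^n⇔UniqueNeighbours D) (crank≡2^n (lower (conj D) (conj-InF D))))
    (λ un → (conj D , conj-InF D , from (crank≡2^n⇔UniqueNeighbours D) un) , λ _ f∈F → 2^n≤rank un f∈F)

  minrank≡2^n⇔UniqueNeighbours : MinRankAllIs D (2 ^ n) ⇔ UniqueNeighbours D
  minrank≡2^n⇔UniqueNeighbours = mk⇔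
    (λ (_ , lower) → to (crank≡2^n⇔UniqueNeighbours D) (crank≡2^n (lower 2 ≤-refl (conj D) (conj-InF D))))
    (λ un → (2 , ≤-refl , conj D , conj-InF D , from (crank≡2^n⇔UniqueNeighbours D) un)
          , λ _ _ _ f∈F → 2^n≤rank un f∈F)

-- The canonical version

module _ {n : ℕ} {D : Digraph n} (un : UniqueNeighbours D) where
  open UniqueNeighbours un

  ¬Redundant₁ : ∀ v → ¬ Redundant₁ D v
  ¬Redundant₁ v (S , v∉S , sameInNeighbours , _) with from (sameInNeighbours (pred v)) (pred-arc v)
  ... | s , s∈S , pred→s = v∉S (subst (_∈ₛ S) (trans (arc⇒≡succ pred→s) (succ∘pred v)) s∈S)

  ¬Redundant₀ : ∀ u → ¬ Redundant₀ D u
  ¬Redundant₀ u (inj₁ isolated)              = isolated (succ u , succ-arc u , ¬Redundant₁ (succ u))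
  ¬Redundant₀ u (inj₂ (u′ , u′<u , sameOut)) = FinP.<-irrefl u′≡u u′<u
    where
    u′≡u : u′ ≡ u
    u′≡u = in-unique (proj₁ (from (sameOut (succ u)) (succ-arc u , ¬Redundant₁ (succ u)))) (succ-arc u)

  canonicalIsNP1 : CanonicalIsNP1 D
  canonicalIsNP1 = φ , φ-injective , vertices , arcs
    where
    φ : Side × Fin n → Side × Fin n
    φ (V₀ , i) = V₀ , i
    φ (V₁ , i) = V₁ , succ i
    φ-injective : Injective _≡_ _≡_ φ
    φ-injective {V₀ , i} {V₀ , .i} refl = refl
    φ-injective {V₁ , i} {V₁ , j} eq    =
      cong (V₁ ,_) (trans (sym (pred∘succ i)) (trans (cong (λ x → pred (proj₂ x)) eq) (pred∘succ j)))
    vertices : ∀ x → CVertex D x ⇔ (∃[ y ] φ y ≡ x)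
    vertices (V₀ , u) = mk⇔ (λ _ → (V₀ , u) , refl) (λ _ → ¬Redundant₀ u)
    vertices (V₁ , v) = mk⇔ (λ _ → (V₁ , pred v) , cong (V₁ ,_) (succ∘pred v)) (λ _ → ¬Redundant₁ v)
    arcs : ∀ y y′ → CArc D (φ y) (φ y′) ⇔ P1Arc y y′
    arcs (V₀ , i) (V₁ , j) = mk⇔ (λ (i→succj , _) → trans (arc⇒≡pred i→succj) (pred∘succ j))
                                 (λ { refl → succ-arc i , ¬Redundant₀ i , ¬Redundant₁ (succ i) })
    arcs (V₀ , _) (V₀ , _) = mk⇔ (λ ()) (λ ())
    arcs (V₁ , _) (V₀ , _) = mk⇔ (λ ()) (λ ())
    arcs (V₁ , _) (V₁ , _) = mk⇔ (λ ()) (λ ())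

P1Arc-out-unique : ∀ {n} {x y z : Side × Fin n} → P1Arc x y → P1Arc x z → y ≡ z
P1Arc-out-unique {x = V₀ , _} {V₁ , _} {V₁ , _} refl refl = refl

P1Arc-in-unique : ∀ {n} {x y z : Side × Fin n} → P1Arc x z → P1Arc y z → x ≡ y
P1Arc-in-unique {x = V₀ , _} {V₀ , _} {V₁ , _} refl refl = refl

_≟Side_ : DecidableEquality Side
V₀ ≟Side V₀ = yes refl
V₁ ≟Side V₁ = yes refl
V₀ ≟Side V₁ = no λ ()
V₁ ≟Side V₀ = no λ ()

allVertices : ∀ n → List (Side × Fin n)
allVertices n = cartesianProduct (V₀ ∷ V₁ ∷ []) (allFin n)

allVertices-unique : ∀ n → Unique (allVertices n)
allVertices-unique n = Unique.cartesianProduct⁺ (((λ ()) ∷ []) ∷ [] ∷ []) (Unique.allFin⁺ n)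

allVertices-complete : ∀ {n} (x : Side × Fin n) → x ∈ allVertices n
allVertices-complete (V₀ , i) = ∈-cartesianProduct⁺ {xs = V₀ ∷ V₁ ∷ []} (here refl) (∈-allFin i)
allVertices-complete (V₁ , i) = ∈-cartesianProduct⁺ {xs = V₀ ∷ V₁ ∷ []} (there (here refl)) (∈-allFin i)

module _ {n : ℕ} (D : Digraph n) where

  -- For S = ∅ the condition N⁻(S) = N⁻(v₁) says that v has no in-neighbour.
  ¬Redundant₁⇒inNeighbour : ∀ v → ¬ Redundant₁ D v → ∃[ u ] Arc D u v
  ¬Redundant₁⇒inNeighbour v nonRedundant with FinP.any? (λ u → D u v Bool.≟ true)
  ... | yes inNeighbour = inNeighbour
  ... | no  none        =
    contradiction (∅ , ∉⊥ , noInNeighbours , λ _ u∈∅ → contradiction u∈∅ ∉⊥) nonRedundant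
    where
    noInNeighbours : ∀ w → (∃[ s ] (s ∈ₛ ∅ × Arc D w s)) ⇔ Arc D w v
    noInNeighbours w = mk⇔ (λ (_ , s∈∅ , _) → contradiction s∈∅ ∉⊥)
                           (λ wv → contradiction (w , wv) none)

  ¬Redundant₀⇒outNeighbour : ∀ u → ¬ Redundant₀ D u → ∃[ w ] Arc D u w
  ¬Redundant₀⇒outNeighbour u nonRedundant with FinP.any? (λ w → D u w Bool.≟ true)
  ... | yes outNeighbour = outNeighbour
  ... | no  none         = contradiction (inj₁ λ (w , uw , _) → none (w , uw)) nonRedundant

  canonicalIsNP1⇒UniqueNeighbours : CanonicalIsNP1 D → UniqueNeighbours D
  canonicalIsNP1⇒UniqueNeighbours (φ , φ-injective , vertices , arcs) = record
    { succ = λ u → proj₁ (out u) ; succ-arc = λ u → proj₂ (out u)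
    ; pred = λ v → proj₁ (inn v) ; pred-arc = λ v → proj₂ (inn v)
    ; out-unique = λ uv uw → cong proj₂ (ψ-injective (P1Arc-out-unique (arc⇒P1Arc uv) (arc⇒P1Arc uw)))
    ; in-unique  = λ uw vw → cong proj₂ (ψ-injective (P1Arc-in-unique (arc⇒P1Arc uw) (arc⇒P1Arc vw)))
    }
    where
    φ-surjective : ∀ x → ∃[ y ] φ y ≡ x
    φ-surjective = injective⇒surjective (≡-dec× _≟Side_ Fin._≟_) (allVertices n) (allVertices-unique n)
                                        allVertices-complete φ φ-injective
    ψ : Side × Fin n → Side × Fin n
    ψ x = proj₁ (φ-surjective x)
    φ∘ψ : ∀ x → φ (ψ x) ≡ x
    φ∘ψ x = proj₂ (φ-surjective x)
    ψ-injective : Injective _≡_ _≡_ ψ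
    ψ-injective {x} {y} same = trans (sym (φ∘ψ x)) (trans (cong φ same) (φ∘ψ y))
    vertex : ∀ x → CVertex D x
    vertex x = from (vertices x) (φ-surjective x)
    arc⇒P1Arc : ∀ {u v} → Arc D u v → P1Arc (ψ (V₀ , u)) (ψ (V₁ , v))
    arc⇒P1Arc {u} {v} uv = to (arcs _ _)
      (subst₂ (CArc D) (sym (φ∘ψ _)) (sym (φ∘ψ _)) (uv , vertex (V₀ , u) , vertex (V₁ , v)))
    out : ∀ u → ∃[ w ] Arc D u w
    out u = ¬Redundant₀⇒outNeighbour u (vertex (V₀ , u))
    inn : ∀ v → ∃[ u ] Arc D u v
    inn v = ¬Redundant₁⇒inNeighbour v (vertex (V₁ , v))

  canonicalIsNP1⇔UniqueNeighbours : CanonicalIsNP1 D ⇔ UniqueNeighbours D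
  canonicalIsNP1⇔UniqueNeighbours = mk⇔ canonicalIsNP1⇒UniqueNeighbours canonicalIsNP1

theorem3p9 : (n : ℕ) (D : Digraph n) →
    ((crank D ≡ 2 ^ n) ⇔ DisjointUnionOfCycles D)
    × ((MinRankIs D 2 (2 ^ n)) ⇔ DisjointUnionOfCycles D)
    × ((MinRankAllIs D (2 ^ n)) ⇔ DisjointUnionOfCycles D)
    × (CanonicalIsNP1 D ⇔ DisjointUnionOfCycles D)
theorem3p9 n D =
    viaUniqueNeighbours (crank≡2^n⇔UniqueNeighbours D)
  , viaUniqueNeighbours (minrank₂≡2^n⇔UniqueNeighbours D)
  , viaUniqueNeighbours (minrank≡2^n⇔UniqueNeighbours D)
  , viaUniqueNeighbours (canonicalIsNP1⇔UniqueNeighbours D)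
  where
  viaUniqueNeighbours : ∀ {P : Set} → P ⇔ UniqueNeighbours D → P ⇔ DisjointUnionOfCycles D
  viaUniqueNeighbours P⇔UN = UniqueNeighbours⇔DisjointUnionOfCycles D ⇔-∘ P⇔UN
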